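{- For every $n\ge 2$, the set of admitted vectors in $\mathbb{N}^T$, ordered componentwise, is a lattice (equivalently, the poset of circular permutations of $S_n$ is a lattice).
   Context: $T=\{(i,j):1\le i<j\le n\}$, $\mathbb N$ the nonnegative integers. A vector $v\in\mathbb{N}^T$ is admitted if $v_{i,i+1}=0$ for all $1\le i<n$ and $v_{ij}+v_{jk}\le v_{ik}\le v_{ij}+v_{jk}+1$ for all $1\le i<j<k\le n$. The poset of circular permutations ($n$-cycles of $S_n$) is ordered by the reflexive transitive closure of $(w)\to(w')$, where $(w)$ is the cycle $w_1\mapsto\cdots\mapsto w_n\mapsto w_1$, $w$ has a circular factor $sr$ with $s>r+1$ (a contiguous factor of a cyclic rotation of the word $w$), and $w'$ is obtained by replacing it with $rs$; it is isomorphic to the poset of admitted vectors. -}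

module Defs where

open import Data.Nat using (ℕ; suc; _+_; _≤_; _<_)
open import Data.Product using (Σ; _×_; proj₁)
open import Relation.Binary.PropositionalEquality using (_≡_)

-- A vector in ℕ^T, T = {(i,j) : 1 ≤ i < j ≤ n}, is represented by a function
-- v : ℕ → ℕ → ℕ whose value v i j is the coordinate v_{ij}; only the values at
-- (i,j) ∈ T matter: equality and order below only inspect those coordinates,
-- so the setoid of such functions is exactly ℕ^T.
Vec-T : Set
Vec-T = ℕ → ℕ → ℕ

_≈T[_]_ : Vec-T → ℕ → Vec-T → Set
v ≈T[ n ] w = ∀ i j → 1 ≤ i → i < j → j ≤ n → v i j ≡ w i j

_≤T[_]_ : Vec-T → ℕ → Vec-T → Set
v ≤T[ n ] w = ∀ i j → 1 ≤ i → i < j → j ≤ n → v i j ≤ w i j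

Admitted : ℕ → Vec-T → Set
Admitted n v =
  (∀ i → 1 ≤ i → i < n → v i (suc i) ≡ 0)
  × (∀ i j k → 1 ≤ i → i < j → j < k → k ≤ n →
       (v i j + v j k ≤ v i k) × (v i k ≤ v i j + v j k + 1))

AdmittedVec : ℕ → Set
AdmittedVec n = Σ Vec-T (Admitted n)

_≈A_ : ∀ {n} → AdmittedVec n → AdmittedVec n → Set
_≈A_ {n} x y = proj₁ x ≈T[ n ] proj₁ y

_≤A_ : ∀ {n} → AdmittedVec n → AdmittedVec n → Set
_≤A_ {n} x y = proj₁ x ≤T[ n ] proj₁ y

module Submission where

-- The join of u and v is the least superadditive vector above u ⊔ v. It is reached by
-- repeatedly raising w_ik to max(w_ik, w_ij + w_jk) over i < j < k; after n rounds
-- nothing changes on T, so the result is superadditive. Each round also preserves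
-- w_ik ≤ w_ij + w_jk + 1: a raised value w_il + w_lk is split at j by applying that
-- bound to the triple (l,j,k) or (i,j,l), which leaves a sum that the round has just
-- absorbed into w_ij or w_jk. Adjacent coordinates are never raised. The meet is the
-- exact dual: the greatest vector below u ⊓ v satisfying the +1 bound, obtained by
-- lowering w_ik to min(w_ik, w_ij + w_jk + 1), which preserves superadditivity.

open import Defs
open import Algebra.Core using (Op₂)
open import Data.Empty using (⊥; ⊥-elim)
open import Data.List using (List; map; filter; upTo)
open import Data.List.Extrema.Nat
  using (max; min; ⊥≤max; xs≤max; max≤v⁺; min≤⊤; min≤xs; v≤min⁺)
open import Data.List.Membership.Propositional using (_∈_)
open import Data.List.Membership.Propositional.Properties
  using (∈-map⁺; ∈-filter⁺; ∈-filter⁻; ∈-upTo⁺; ∈-upTo⁻)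
import Data.List.Relation.Unary.All as All
open import Data.List.Relation.Unary.All.Properties using (map⁺)
open import Data.Nat using (ℕ; zero; suc; s≤s; _+_; _≤_; _<_; _<?_; _⊔_; _⊓_)
open import Data.Nat.Properties
open import Data.Nat.Tactic.RingSolver using (solve-∀)
open import Data.Product using (Σ; _×_; _,_; proj₁; proj₂)
open import Relation.Binary.Definitions using (Tri; tri<; tri≈; tri>)
open import Relation.Binary.Lattice.Definitions using (Supremum; Infimum)
open import Relation.Binary.Lattice.Structures using (IsLattice)
open import Relation.Binary.PropositionalEquality using (_≡_; refl; sym; trans; cong₂)
open import Relation.Binary.Structures using (IsPartialOrder)

between : ℕ → ℕ → List ℕ
between i k = filter (i <?_) (upTo k)

∈-between⁺ : ∀ {i j k} → i < j → j < k → j ∈ between i k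
∈-between⁺ i<j j<k = ∈-filter⁺ (_ <?_) (∈-upTo⁺ j<k) i<j

∈-between⁻ : ∀ {i j k} → j ∈ between i k → i < j × j < k
∈-between⁻ j∈ with j∈upTo , i<j ← ∈-filter⁻ (_ <?_) j∈ = i<j , ∈-upTo⁻ j∈upTo

private variable
  i j k b z : ℕ
  f : ℕ → ℕ

-- Opaque so that maxBetween i k b f is not unfolded to a foldr during unification.
opaque
  maxBetween : ℕ → ℕ → ℕ → (ℕ → ℕ) → ℕ
  maxBetween i k b f = max b (map f (between i k))

  minBetween : ℕ → ℕ → ℕ → (ℕ → ℕ) → ℕ
  minBetween i k b f = min b (map f (between i k))

  b≤maxBetween : b ≤ maxBetween i k b f
  b≤maxBetween {b} {i} {k} {f} = ⊥≤max b (map f (between i k))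

  f≤maxBetween : i < j → j < k → f j ≤ maxBetween i k b f
  f≤maxBetween i<j j<k =
    All.lookup (xs≤max _ _) (∈-map⁺ _ (∈-between⁺ i<j j<k))

  maxBetween≤ : b ≤ z → (∀ j → i < j → j < k → f j ≤ z) → maxBetween i k b f ≤ z
  maxBetween≤ b≤z f≤z =
    max≤v⁺ b≤z (map⁺ (All.tabulate λ j∈ →
      let i<j , j<k = ∈-between⁻ j∈ in f≤z _ i<j j<k))

  minBetween≤b : minBetween i k b f ≤ b
  minBetween≤b {i} {k} {b} {f} = min≤⊤ b (map f (between i k))

  minBetween≤f : i < j → j < k → minBetween i k b f ≤ f j
  minBetween≤f i<j j<k =
    All.lookup (min≤xs _ _) (∈-map⁺ _ (∈-between⁺ i<j j<k))

  ≤minBetween : z ≤ b → (∀ j → i < j → j < k → z ≤ f j) → z ≤ minBetween i k b f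
  ≤minBetween z≤b z≤f =
    v≤min⁺ z≤b (map⁺ (All.tabulate λ j∈ →
      let i<j , j<k = ∈-between⁻ j∈ in z≤f _ i<j j<k))

∄-between-adjacent : ∀ {i j} → i < j → j < suc i → ⊥
∄-between-adjacent i<j j<1+i = <⇒≱ i<j (≤-pred j<1+i)

maxBetween-adjacent : ∀ i b f → maxBetween i (suc i) b f ≡ b
maxBetween-adjacent i b f = ≤-antisym
  (maxBetween≤ ≤-refl λ _ i<j j<1+i → ⊥-elim (∄-between-adjacent i<j j<1+i))
  b≤maxBetween

minBetween-adjacent : ∀ i b f → minBetween i (suc i) b f ≡ b
minBetween-adjacent i b f = ≤-antisym
  minBetween≤b
  (≤minBetween ≤-refl λ _ i<j j<1+i → ⊥-elim (∄-between-adjacent i<j j<1+i))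

Superadditive : ℕ → Vec-T → Set
Superadditive n v = ∀ i j k → 1 ≤ i → i < j → j < k → k ≤ n → v i j + v j k ≤ v i k

SubadditiveUpToOne : ℕ → Vec-T → Set
SubadditiveUpToOne n v = ∀ i j k → 1 ≤ i → i < j → j < k → k ≤ n → v i k ≤ v i j + v j k + 1

+-regroup-≤ˡ : ∀ {x y x′ y′ z p q} →
  x ≤ x′ → y ≤ y′ + z + 1 → x′ + y′ ≤ p → z ≤ q → x + y ≤ p + q + 1
+-regroup-≤ˡ {x′ = x′} {y′} {z} x≤ y≤ x′y′≤p z≤q = begin
  _                  ≤⟨ +-mono-≤ x≤ y≤ ⟩
  x′ + (y′ + z + 1)  ≡⟨ regroup x′ y′ z ⟩
  x′ + y′ + z + 1    ≤⟨ +-monoˡ-≤ 1 (+-mono-≤ x′y′≤p z≤q) ⟩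
  _                  ∎
  where
  open ≤-Reasoning
  regroup : ∀ a b c → a + (b + c + 1) ≡ a + b + c + 1
  regroup = solve-∀

+-regroup-≤ʳ : ∀ {x y x′ y′ z p q} →
  x ≤ x′ + y′ + 1 → y ≤ z → x′ ≤ p → y′ + z ≤ q → x + y ≤ p + q + 1
+-regroup-≤ʳ {x′ = x′} {y′} {z} x≤ y≤ x′≤p y′z≤q = begin
  _                  ≤⟨ +-mono-≤ x≤ y≤ ⟩
  x′ + y′ + 1 + z    ≡⟨ regroup x′ y′ z ⟩
  x′ + (y′ + z) + 1  ≤⟨ +-monoˡ-≤ 1 (+-mono-≤ x′≤p y′z≤q) ⟩
  _                  ∎
  where
  open ≤-Reasoning
  regroup : ∀ a b c → a + b + 1 + c ≡ a + (b + c) + 1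
  regroup = solve-∀

stable-split-left : ∀ d → k ≤ suc (suc d + i) → j < k → j ≤ suc (d + i)
stable-split-left d k≤ j<k = ≤-pred (≤-trans j<k k≤)

stable-split-right : ∀ d → k ≤ suc (suc d + i) → i < j → k ≤ suc (d + j)
stable-split-right {i = i} d k≤ i<j =
  ≤-trans k≤ (s≤s (≤-trans (≤-reflexive (sym (+-suc d i))) (+-monoʳ-≤ d i<j)))

module SuperadditiveHull (m : Vec-T) where

  hull : ℕ → Vec-T
  hull zero = m
  hull (suc d) i k = maxBetween i k (hull d i k) (λ j → hull d i j + hull d j k)

  hull-step : ∀ d → hull d i k ≤ hull (suc d) i k
  hull-step d = b≤maxBetween

  hull-split : ∀ d → i < j → j < k → hull d i j + hull d j k ≤ hull (suc d) i k
  hull-split d = f≤maxBetween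

  m≤hull : ∀ d → m i k ≤ hull d i k
  m≤hull zero = ≤-refl
  m≤hull (suc d) = ≤-trans (m≤hull d) (hull-step d)

  hull-stable : ∀ d → k ≤ suc (d + i) → hull (suc d) i k ≤ hull d i k
  hull-stable zero k≤1+i = maxBetween≤ ≤-refl λ _ i<j j<k →
    ⊥-elim (∄-between-adjacent i<j (≤-trans j<k k≤1+i))
  hull-stable (suc d) k≤ = maxBetween≤ ≤-refl λ _ i<j j<k →
    ≤-trans (+-mono-≤ (hull-stable d (stable-split-left d k≤ j<k))
                      (hull-stable d (stable-split-right d k≤ i<j)))
            (hull-split d i<j j<k)

  hull-adjacent : ∀ d i → hull d i (suc i) ≡ m i (suc i)
  hull-adjacent zero i = refl
  hull-adjacent (suc d) i = trans (maxBetween-adjacent i _ _) (hull-adjacent d i)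

  hull-superadditive : ∀ n → Superadditive n (hull n)
  hull-superadditive n i j k _ i<j j<k k≤n =
    ≤-trans (hull-split n i<j j<k) (hull-stable n (≤-trans k≤n (≤-trans (m≤m+n n i) (n≤1+n _))))

  hull-least : ∀ {n z} → Superadditive n z → m ≤T[ n ] z → ∀ d → hull d ≤T[ n ] z
  hull-least z-sup m≤z zero = m≤z
  hull-least z-sup m≤z (suc d) i k 1≤i i<k k≤n =
    maxBetween≤ (IH i k 1≤i i<k k≤n) λ j i<j j<k →
      ≤-trans (+-mono-≤ (IH i j 1≤i i<j (≤-trans (<⇒≤ j<k) k≤n))
                        (IH j k (≤-trans 1≤i (<⇒≤ i<j)) j<k k≤n))
              (z-sup i j k 1≤i i<j j<k k≤n)
    where IH = hull-least z-sup m≤z d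

  hull-subadditiveUpToOne : ∀ {n} → SubadditiveUpToOne n m →
    ∀ d → SubadditiveUpToOne n (hull d)
  hull-subadditiveUpToOne m-sub zero = m-sub
  hull-subadditiveUpToOne m-sub (suc d) i j k 1≤i i<j j<k k≤n =
    maxBetween≤ (≤-trans (IH i j k 1≤i i<j j<k k≤n)
                         (+-monoˡ-≤ 1 (+-mono-≤ (hull-step d) (hull-step d))))
                (λ l i<l l<k → candidate l i<l l<k (<-cmp l j))
    where
    IH = hull-subadditiveUpToOne m-sub d
    candidate : ∀ l → i < l → l < k → Tri (l < j) (l ≡ j) (j < l) →
      hull d i l + hull d l k ≤ hull (suc d) i j + hull (suc d) j k + 1
    candidate l i<l l<k (tri< l<j _ _) =
      +-regroup-≤ˡ ≤-refl (IH l j k (≤-trans 1≤i (<⇒≤ i<l)) l<j j<k k≤n)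
                   (hull-split d i<l l<j) (hull-step d)
    candidate l i<l l<k (tri≈ _ refl _) = ≤-trans (+-mono-≤ (hull-step d) (hull-step d)) (m≤m+n _ 1)
    candidate l i<l l<k (tri> _ _ j<l) =
      +-regroup-≤ʳ (IH i j l 1≤i i<j j<l (≤-trans (<⇒≤ l<k) k≤n)) ≤-refl
                   (hull-step d) (hull-split d j<l l<k)

module SubadditiveCore (m : Vec-T) where

  core : ℕ → Vec-T
  core zero = m
  core (suc d) i k = minBetween i k (core d i k) (λ j → core d i j + core d j k + 1)

  core-step : ∀ d → core (suc d) i k ≤ core d i k
  core-step d = minBetween≤b

  core-split : ∀ d → i < j → j < k → core (suc d) i k ≤ core d i j + core d j k + 1
  core-split d = minBetween≤f

  core≤m : ∀ d → core d i k ≤ m i k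
  core≤m zero = ≤-refl
  core≤m (suc d) = ≤-trans (core-step d) (core≤m d)

  core-stable : ∀ d → k ≤ suc (d + i) → core d i k ≤ core (suc d) i k
  core-stable zero k≤1+i = ≤minBetween ≤-refl λ _ i<j j<k →
    ⊥-elim (∄-between-adjacent i<j (≤-trans j<k k≤1+i))
  core-stable (suc d) k≤ = ≤minBetween ≤-refl λ _ i<j j<k →
    ≤-trans (core-split d i<j j<k)
            (+-monoˡ-≤ 1 (+-mono-≤ (core-stable d (stable-split-left d k≤ j<k))
                                   (core-stable d (stable-split-right d k≤ i<j))))

  core-adjacent : ∀ d i → core d i (suc i) ≡ m i (suc i)
  core-adjacent zero i = refl
  core-adjacent (suc d) i = trans (minBetween-adjacent i _ _) (core-adjacent d i)

  core-subadditiveUpToOne : ∀ n → SubadditiveUpToOne n (core n)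
  core-subadditiveUpToOne n i j k _ i<j j<k k≤n =
    ≤-trans (core-stable n (≤-trans k≤n (≤-trans (m≤m+n n i) (n≤1+n _)))) (core-split n i<j j<k)

  core-greatest : ∀ {n z} → SubadditiveUpToOne n z → z ≤T[ n ] m → ∀ d → z ≤T[ n ] core d
  core-greatest z-sub z≤m zero = z≤m
  core-greatest z-sub z≤m (suc d) i k 1≤i i<k k≤n =
    ≤minBetween (IH i k 1≤i i<k k≤n) λ j i<j j<k →
      ≤-trans (z-sub i j k 1≤i i<j j<k k≤n)
              (+-monoˡ-≤ 1 (+-mono-≤ (IH i j 1≤i i<j (≤-trans (<⇒≤ j<k) k≤n))
                                     (IH j k (≤-trans 1≤i (<⇒≤ i<j)) j<k k≤n)))
    where IH = core-greatest z-sub z≤m d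

  core-superadditive : ∀ {n} → Superadditive n m → ∀ d → Superadditive n (core d)
  core-superadditive m-sup zero = m-sup
  core-superadditive m-sup (suc d) i j k 1≤i i<j j<k k≤n =
    ≤minBetween (≤-trans (+-mono-≤ (core-step d) (core-step d))
                         (IH i j k 1≤i i<j j<k k≤n))
                (λ l i<l l<k → candidate l i<l l<k (<-cmp l j))
    where
    IH = core-superadditive m-sup d
    candidate : ∀ l → i < l → l < k → Tri (l < j) (l ≡ j) (j < l) →
      core (suc d) i j + core (suc d) j k ≤ core d i l + core d l k + 1
    candidate l i<l l<k (tri< l<j _ _) =
      +-regroup-≤ʳ (core-split d i<l l<j) (core-step d) ≤-refl
                   (IH l j k (≤-trans 1≤i (<⇒≤ i<l)) l<j j<k k≤n)
    candidate l i<l l<k (tri≈ _ refl _) = ≤-trans (+-mono-≤ (core-step d) (core-step d)) (m≤m+n _ 1)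
    candidate l i<l l<k (tri> _ _ j<l) =
      +-regroup-≤ˡ (core-step d) (core-split d j<l l<k)
                   (IH i j l 1≤i i<j j<l (≤-trans (<⇒≤ l<k) k≤n)) ≤-refl

_⊔T_ : Vec-T → Vec-T → Vec-T
(u ⊔T v) i k = u i k ⊔ v i k

_⊓T_ : Vec-T → Vec-T → Vec-T
(u ⊓T v) i k = u i k ⊓ v i k

⊔-subadditiveUpToOne : ∀ {n u v} → SubadditiveUpToOne n u → SubadditiveUpToOne n v →
  SubadditiveUpToOne n (u ⊔T v)
⊔-subadditiveUpToOne {u = u} {v} u-sub v-sub i j k 1≤i i<j j<k k≤n = ⊔-lub
  (≤-trans (u-sub i j k 1≤i i<j j<k k≤n)
           (+-monoˡ-≤ 1 (+-mono-≤ (m≤m⊔n (u i j) (v i j)) (m≤m⊔n (u j k) (v j k)))))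
  (≤-trans (v-sub i j k 1≤i i<j j<k k≤n)
           (+-monoˡ-≤ 1 (+-mono-≤ (m≤n⊔m (u i j) (v i j)) (m≤n⊔m (u j k) (v j k)))))

⊓-superadditive : ∀ {n u v} → Superadditive n u → Superadditive n v → Superadditive n (u ⊓T v)
⊓-superadditive {u = u} {v} u-sup v-sup i j k 1≤i i<j j<k k≤n = ⊓-glb
  (≤-trans (+-mono-≤ (m⊓n≤m (u i j) (v i j)) (m⊓n≤m (u j k) (v j k)))
           (u-sup i j k 1≤i i<j j<k k≤n))
  (≤-trans (+-mono-≤ (m⊓n≤n (u i j) (v i j)) (m⊓n≤n (u j k) (v j k)))
           (v-sup i j k 1≤i i<j j<k k≤n))

module _ {n : ℕ} {v : Vec-T} where

  admitted⇒superadditive : Admitted n v → Superadditive n v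
  admitted⇒superadditive (_ , bounds) i j k 1≤i i<j j<k k≤n =
    proj₁ (bounds i j k 1≤i i<j j<k k≤n)

  admitted⇒subadditiveUpToOne : Admitted n v → SubadditiveUpToOne n v
  admitted⇒subadditiveUpToOne (_ , bounds) i j k 1≤i i<j j<k k≤n =
    proj₂ (bounds i j k 1≤i i<j j<k k≤n)

  admitted : (∀ i → 1 ≤ i → i < n → v i (suc i) ≡ 0) →
    Superadditive n v → SubadditiveUpToOne n v → Admitted n v
  admitted adjacent sup sub = adjacent , λ i j k 1≤i i<j j<k k≤n →
    sup i j k 1≤i i<j j<k k≤n , sub i j k 1≤i i<j j<k k≤n

module _ (n : ℕ) where
  open SuperadditiveHull
  open SubadditiveCore

  joinT : Vec-T → Vec-T → Vec-T
  joinT u v = hull (u ⊔T v) n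

  meetT : Vec-T → Vec-T → Vec-T
  meetT u v = core (u ⊓T v) n

  joinT-admitted : ∀ {u v} → Admitted n u → Admitted n v → Admitted n (joinT u v)
  joinT-admitted {u} {v} u-adm v-adm = admitted
    (λ i 1≤i i<n → trans (hull-adjacent (u ⊔T v) n i)
                         (cong₂ _⊔_ (proj₁ u-adm i 1≤i i<n) (proj₁ v-adm i 1≤i i<n)))
    (hull-superadditive (u ⊔T v) n)
    (hull-subadditiveUpToOne (u ⊔T v)
      (⊔-subadditiveUpToOne (admitted⇒subadditiveUpToOne u-adm) (admitted⇒subadditiveUpToOne v-adm)) n)

  meetT-admitted : ∀ {u v} → Admitted n u → Admitted n v → Admitted n (meetT u v)
  meetT-admitted {u} {v} u-adm v-adm = admitted
    (λ i 1≤i i<n → trans (core-adjacent (u ⊓T v) n i)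
                         (cong₂ _⊓_ (proj₁ u-adm i 1≤i i<n) (proj₁ v-adm i 1≤i i<n)))
    (core-superadditive (u ⊓T v)
      (⊓-superadditive (admitted⇒superadditive u-adm) (admitted⇒superadditive v-adm)) n)
    (core-subadditiveUpToOne (u ⊓T v) n)

  _∨_ : Op₂ (AdmittedVec n)
  (u , u-adm) ∨ (v , v-adm) = joinT u v , joinT-admitted u-adm v-adm

  _∧_ : Op₂ (AdmittedVec n)
  (u , u-adm) ∧ (v , v-adm) = meetT u v , meetT-admitted u-adm v-adm

  ≤A-isPartialOrder : IsPartialOrder (_≈A_ {n}) (_≤A_ {n})
  ≤A-isPartialOrder = record
    { isPreorder = record
      { isEquivalence = record
        { refl  = λ _ _ _ _ _ → refl
        ; sym   = λ x≈y i k 1≤i i<k k≤n → sym (x≈y i k 1≤i i<k k≤n)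
        ; trans = λ x≈y y≈z i k 1≤i i<k k≤n →
                    trans (x≈y i k 1≤i i<k k≤n) (y≈z i k 1≤i i<k k≤n)
        }
      ; reflexive = λ x≈y i k 1≤i i<k k≤n → ≤-reflexive (x≈y i k 1≤i i<k k≤n)
      ; trans     = λ x≤y y≤z i k 1≤i i<k k≤n →
                        ≤-trans (x≤y i k 1≤i i<k k≤n) (y≤z i k 1≤i i<k k≤n)
      }
    ; antisym = λ x≤y y≤x i k 1≤i i<k k≤n →
                  ≤-antisym (x≤y i k 1≤i i<k k≤n) (y≤x i k 1≤i i<k k≤n)
    }

  ∨-supremum : Supremum (_≤A_ {n}) _∨_
  ∨-supremum (u , _) (v , _) =
    (λ i k _ _ _ → ≤-trans (m≤m⊔n (u i k) (v i k)) (m≤hull (u ⊔T v) n)) ,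
    (λ i k _ _ _ → ≤-trans (m≤n⊔m (u i k) (v i k)) (m≤hull (u ⊔T v) n)) ,
    λ (z , z-adm) u≤z v≤z → hull-least (u ⊔T v) (admitted⇒superadditive z-adm)
      (λ i k 1≤i i<k k≤n → ⊔-lub (u≤z i k 1≤i i<k k≤n) (v≤z i k 1≤i i<k k≤n)) n

  ∧-infimum : Infimum (_≤A_ {n}) _∧_
  ∧-infimum (u , _) (v , _) =
    (λ i k _ _ _ → ≤-trans (core≤m (u ⊓T v) n) (m⊓n≤m (u i k) (v i k))) ,
    (λ i k _ _ _ → ≤-trans (core≤m (u ⊓T v) n) (m⊓n≤n (u i k) (v i k))) ,
    λ (z , z-adm) z≤u z≤v → core-greatest (u ⊓T v) (admitted⇒subadditiveUpToOne z-adm)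
      (λ i k 1≤i i<k k≤n → ⊓-glb (z≤u i k 1≤i i<k k≤n) (z≤v i k 1≤i i<k k≤n)) n

theorem4p1 : (n : ℕ) → 2 ≤ n →
    Σ (Op₂ (AdmittedVec n)) λ _∨_ → Σ (Op₂ (AdmittedVec n)) λ _∧_ →
    IsLattice (_≈A_ {n}) (_≤A_ {n}) _∨_ _∧_
theorem4p1 n _ = _∨_ n , _∧_ n , record
  { isPartialOrder = ≤A-isPartialOrder n
  ; supremum       = ∨-supremum n
  ; infimum        = ∧-infimum n
  }
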